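{- Let $k\ge 3$ and let $\mathcal{A}_0\subset\{0,1\}^n$ be the initially infected set. The $3$-neighbor bootstrap percolation process on $Q_{n,k}$ started from $\mathcal{A}_0$ percolates if and only if there exist (distinct) vertices $x_1,x_2,x_3\in\mathcal{A}_0$ whose pairwise Hamming distances are all at most $2k$.
   Context: $Q_{n,k}$ is the graph with vertex set $\{0,1\}^n$ in which $x,y$ are adjacent iff $1\le d_H(x,y)\le k$ ($d_H$ = Hamming distance). The $r$-neighbor bootstrap percolation process from $\mathcal{A}_0\subset V$: $\mathcal{A}_i=\mathcal{A}_{i-1}\cup\{v: |N_v\cap\mathcal{A}_{i-1}|\ge r\}$, where $N_v$ is the neighborhood of $v$; it percolates if $\mathcal{A}_i=V$ for some $i$. -}

module Defs where

open import Data.Nat using (ℕ; zero; suc; _+_; _*_; _≤_; _≤ᵇ_)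
open import Data.Bool using (Bool; true; false; _∧_; _∨_; if_then_else_)
open import Data.Vec using (Vec; []; _∷_)
open import Data.List using (List; []; _∷_; map; _++_; filter; length)
open import Relation.Nullary.Decidable using (Dec; yes; no)
open import Relation.Binary.PropositionalEquality using (_≡_)
open import Data.Product using (Σ)

Vertex : ℕ → Set
Vertex n = Vec Bool n

dH : ∀ {n} → Vertex n → Vertex n → ℕ
dH []      []      = 0
dH (a ∷ x) (b ∷ y) with a | b
... | true  | true  = dH x y
... | false | false = dH x y
... | true  | false = suc (dH x y)
... | false | true  = suc (dH x y)

allVertices : (n : ℕ) → List (Vertex n)
allVertices zero    = [] ∷ []
allVertices (suc n) = map (true ∷_) (allVertices n) ++ map (false ∷_) (allVertices n)

adjᵇ : ∀ {n} → ℕ → Vertex n → Vertex n → Bool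
adjᵇ k x y = (1 ≤ᵇ dH x y) ∧ (dH x y ≤ᵇ k)

VSet : ℕ → Set
VSet n = Vertex n → Bool

nbrCount : ∀ {n} → ℕ → VSet n → Vertex n → ℕ
nbrCount {n} k A v = length (filter (λ u → T? (adjᵇ k v u ∧ A u)) (allVertices n))
  where
  T? : (b : Bool) → Dec (b ≡ true)
  T? true  = yes _≡_.refl
  T? false = no (λ ())

step : ∀ {n} → ℕ → ℕ → VSet n → VSet n
step k r A v = A v ∨ (r ≤ᵇ nbrCount k A v)

infected : ∀ {n} → ℕ → ℕ → VSet n → ℕ → VSet n
infected k r A₀ zero    = A₀
infected k r A₀ (suc i) = step k r (infected k r A₀ i)

Percolates : ∀ {n} → ℕ → ℕ → VSet n → Set
Percolates {n} k r A₀ = Σ ℕ (λ i → (v : Vertex n) → infected k r A₀ i v ≡ true)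

{-# OPTIONS --safe #-}
-- If no vertex has three neighbours in A₀, the process never leaves A₀; so if
-- A₀ ≠ V percolates, some vertex has three neighbours in A₀, and these are
-- pairwise within 2k by the triangle inequality.
--
-- Conversely, the set of eventually infected vertices is closed under the rule
-- "within distance k of three distinct members". Hamming balls have the Helly
-- property, so three members pairwise within 2k have a common point c within
-- k of each, and c is infected. If they are even pairwise within 2k − 2, then
-- c can be taken within k − 1 of each, so every neighbour of c is infected;
-- for k ≥ 3 infection then spreads outwards along geodesics from c. If two of
-- them are at distance 2k − 1 or 2k, flipping c towards them produces a vertex
-- whose neighbours all get infected in the same way.
module Submission where

open import Defs
open import Data.Bool using (true; false; not; _∧_; _∨_)
import Data.Bool as Bool
open import Data.Bool.Properties using (T-≡; T-∧; ∨-zeroʳ; not-¬)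
open import Data.Empty using (⊥; ⊥-elim)
open import Data.Fin using (Fin; zero; suc)
open import Data.List using (List; []; _∷_; length; map)
open import Data.List.Membership.Propositional using (_∈_)
open import Data.List.Membership.Propositional.Properties
  using (∈-map⁺; ∈-map⁻; ∈-++⁺ˡ; ∈-++⁺ʳ; ∈-filter⁺; ∈-filter⁻)
open import Data.List.Relation.Unary.All as All using (All; []; _∷_)
open import Data.List.Relation.Unary.All.Properties using (¬Any⇒All¬)
open import Data.List.Relation.Unary.AllPairs using ([]; _∷_)
open import Data.List.Relation.Unary.Any using (here; there; any?; satisfied)
open import Data.List.Relation.Unary.Unique.Propositional using (Unique)
import Data.List.Relation.Unary.Unique.Propositional.Properties as Unique
open import Data.List.Relation.Binary.Sublist.Propositional using (⊆-refl)
open import Data.List.Relation.Binary.Sublist.Propositional.Properties using (filter⁺; length-mono-≤)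
open import Data.Nat
  using (ℕ; zero; suc; _+_; _*_; _⊔_; _≤_; _<_; _≤ᵇ_; _≤′_; ≤′-refl; ≤′-step; z≤n; s≤s; z<s; _≤?_)
open import Data.Nat.Properties
open import Data.Product using (_×_; _,_; ∃-syntax; proj₁; proj₂)
open import Data.Sum using (_⊎_; inj₁; inj₂; [_,_]′)
open import Data.Vec using ([]; _∷_)
open import Data.Vec.Properties using (∷-injectiveʳ; ≡-dec)
open import Function using (_∘_)
open import Function.Bundles using (_⇔_; mk⇔; Equivalence)
open Equivalence using (to; from)
open import Relation.Binary.Definitions using (DecidableEquality)
open import Relation.Binary.PropositionalEquality
open import Relation.Nullary using (¬_; yes; no)

private variable
  n k r m : ℕ
  X : Set
  S : Vertex n → Set
  x₁ x₂ x₃ : Vertex n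

dH-refl : (x : Vertex n) → dH x x ≡ 0
dH-refl []          = refl
dH-refl (true ∷ x)  = dH-refl x
dH-refl (false ∷ x) = dH-refl x

dH≡0⇒≡ : (x y : Vertex n) → dH x y ≡ 0 → x ≡ y
dH≡0⇒≡ []          []          _  = refl
dH≡0⇒≡ (true ∷ x)  (true ∷ y)  eq = cong (true ∷_) (dH≡0⇒≡ x y eq)
dH≡0⇒≡ (false ∷ x) (false ∷ y) eq = cong (false ∷_) (dH≡0⇒≡ x y eq)

dH-sym : (x y : Vertex n) → dH x y ≡ dH y x
dH-sym []          []          = refl
dH-sym (true ∷ x)  (true ∷ y)  = dH-sym x y
dH-sym (false ∷ x) (false ∷ y) = dH-sym x y
dH-sym (true ∷ x)  (false ∷ y) = cong suc (dH-sym x y)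
dH-sym (false ∷ x) (true ∷ y)  = cong suc (dH-sym x y)

dH-triangle : (x y z : Vertex n) → dH x z ≤ dH x y + dH y z
dH-triangle []          []          []          = z≤n
dH-triangle (true ∷ x)  (true ∷ y)  (true ∷ z)  = dH-triangle x y z
dH-triangle (false ∷ x) (false ∷ y) (false ∷ z) = dH-triangle x y z
dH-triangle (true ∷ x)  (false ∷ y) (false ∷ z) = s≤s (dH-triangle x y z)
dH-triangle (false ∷ x) (true ∷ y)  (true ∷ z)  = s≤s (dH-triangle x y z)
dH-triangle (true ∷ x)  (true ∷ y)  (false ∷ z) =
  ≤-trans (s≤s (dH-triangle x y z)) (≤-reflexive (sym (+-suc (dH x y) (dH y z))))
dH-triangle (false ∷ x) (false ∷ y) (true ∷ z)  =
  ≤-trans (s≤s (dH-triangle x y z)) (≤-reflexive (sym (+-suc (dH x y) (dH y z))))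
dH-triangle (true ∷ x)  (false ∷ y) (true ∷ z)  =
  ≤-trans (dH-triangle x y z) (+-mono-≤ (n≤1+n _) (n≤1+n _))
dH-triangle (false ∷ x) (true ∷ y)  (false ∷ z) =
  ≤-trans (dH-triangle x y z) (+-mono-≤ (n≤1+n _) (n≤1+n _))

dH-triangle-≤ : ∀ (x y z : Vertex n) {a b} → dH x y ≤ a → dH y z ≤ b → dH x z ≤ a + b
dH-triangle-≤ x y z x-y y-z = ≤-trans (dH-triangle x y z) (+-mono-≤ x-y y-z)

dH-≤-swap : ∀ a b (x y : Vertex n) → dH x y ≤ a + b → dH y x ≤ b + a
dH-≤-swap a b x y = subst₂ _≤_ (dH-sym x y) (+-comm a b)

≢-by-dH : ∀ {p q y : Vertex n} {a b} → dH p y ≡ a → dH q y ≡ b → a ≢ b → p ≢ q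
≢-by-dH p-y q-y a≢b refl = a≢b (trans (sym p-y) q-y)

_≟ᵛ_ : DecidableEquality (Vertex n)
_≟ᵛ_ = ≡-dec Bool._≟_

flipAt : Fin n → Vertex n → Vertex n
flipAt zero    (a ∷ x) = not a ∷ x
flipAt (suc i) (a ∷ x) = a ∷ flipAt i x

flipAt-involutive : (i : Fin n) (x : Vertex n) → flipAt i (flipAt i x) ≡ x
flipAt-involutive zero    (true ∷ x)  = refl
flipAt-involutive zero    (false ∷ x) = refl
flipAt-involutive (suc i) (a ∷ x)     = cong (a ∷_) (flipAt-involutive i x)

flipAt-injective : (i : Fin n) {x y : Vertex n} → flipAt i x ≡ flipAt i y → x ≡ y
flipAt-injective i {x} {y} eq =
  trans (sym (flipAt-involutive i x)) (trans (cong (flipAt i) eq) (flipAt-involutive i y))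

flipAt-isometry : (i : Fin n) (x y : Vertex n) → dH (flipAt i x) (flipAt i y) ≡ dH x y
flipAt-isometry zero    (true ∷ x)  (true ∷ y)  = refl
flipAt-isometry zero    (true ∷ x)  (false ∷ y) = refl
flipAt-isometry zero    (false ∷ x) (true ∷ y)  = refl
flipAt-isometry zero    (false ∷ x) (false ∷ y) = refl
flipAt-isometry (suc i) (true ∷ x)  (true ∷ y)  = flipAt-isometry i x y
flipAt-isometry (suc i) (true ∷ x)  (false ∷ y) = cong suc (flipAt-isometry i x y)
flipAt-isometry (suc i) (false ∷ x) (true ∷ y)  = cong suc (flipAt-isometry i x y)
flipAt-isometry (suc i) (false ∷ x) (false ∷ y) = flipAt-isometry i x y

dH-flipAtˡ : (i : Fin n) (x : Vertex n) → dH (flipAt i x) x ≡ 1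
dH-flipAtˡ zero    (true ∷ x)  = cong suc (dH-refl x)
dH-flipAtˡ zero    (false ∷ x) = cong suc (dH-refl x)
dH-flipAtˡ (suc i) (true ∷ x)  = dH-flipAtˡ i x
dH-flipAtˡ (suc i) (false ∷ x) = dH-flipAtˡ i x

dH-flipAtʳ : (i : Fin n) (x : Vertex n) → dH x (flipAt i x) ≡ 1
dH-flipAtʳ i x = trans (dH-sym x (flipAt i x)) (dH-flipAtˡ i x)

dH-flipAt-swap : (i : Fin n) (x y : Vertex n) → dH x (flipAt i y) ≡ dH (flipAt i x) y
dH-flipAt-swap i x y = begin
  dH x (flipAt i y)                       ≡⟨ flipAt-isometry i x (flipAt i y) ⟨
  dH (flipAt i x) (flipAt i (flipAt i y)) ≡⟨ cong (dH (flipAt i x)) (flipAt-involutive i y) ⟩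
  dH (flipAt i x) y                       ∎
  where open ≡-Reasoning

stepToward : (x y : Vertex n) → dH x y ≡ suc m → ∃[ i ] dH (flipAt i x) y ≡ m
stepToward []          []          ()
stepToward (true ∷ x)  (false ∷ y) eq = zero , suc-injective eq
stepToward (false ∷ x) (true ∷ y)  eq = zero , suc-injective eq
stepToward (true ∷ x)  (true ∷ y)  eq with stepToward x y eq
... | i , eq′ = suc i , eq′
stepToward (false ∷ x) (false ∷ y) eq with stepToward x y eq
... | i , eq′ = suc i , eq′

stepToward-≢ : (x y : Vertex n) → x ≢ y → ∃[ i ] dH (flipAt i x) y < dH x y
stepToward-≢ x y x≢y with dH x y in eq
... | zero  = ⊥-elim (x≢y (dH≡0⇒≡ x y eq))
... | suc _ = let i , eq′ = stepToward x y eq in i , ≤-reflexive (cong suc eq′)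

HellyTriple : Vertex n → Vertex n → Vertex n → Set
HellyTriple {n} x₁ x₂ x₃ = ∀ r₁ r₂ r₃ →
  dH x₁ x₂ ≤ r₁ + r₂ → dH x₁ x₃ ≤ r₁ + r₃ → dH x₂ x₃ ≤ r₂ + r₃ →
  ∃[ c ] dH c x₁ ≤ r₁ × dH c x₂ ≤ r₂ × dH c x₃ ≤ r₃

-- The tail of a centre for a ∷ x₁, a ∷ x₂, not a ∷ x₃: with head a it must be
-- within r₃ − 1 of x₃, with head (not a) within r₁ − 1 of x₁ and r₂ − 1 of x₂.
data CentreTail (x₁ x₂ x₃ : Vertex n) (r₁ r₂ r₃ : ℕ) : Set where
  majority : ∀ c → dH c x₁ ≤ r₁ → dH c x₂ ≤ r₂ → suc (dH c x₃) ≤ r₃ → CentreTail x₁ x₂ x₃ r₁ r₂ r₃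
  minority : ∀ c → suc (dH c x₁) ≤ r₁ → suc (dH c x₂) ≤ r₂ → dH c x₃ ≤ r₃ → CentreTail x₁ x₂ x₃ r₁ r₂ r₃

centreTail : (x₁ x₂ x₃ : Vertex n) → HellyTriple x₁ x₂ x₃ → ∀ r₁ r₂ r₃ →
  dH x₁ x₂ ≤ r₁ + r₂ → dH x₁ x₃ < r₁ + r₃ → dH x₂ x₃ < r₂ + r₃ → CentreTail x₁ x₂ x₃ r₁ r₂ r₃
centreTail x₁ x₂ x₃ helly r₁ r₂ (suc r₃) d₁₂ d₁₃ d₂₃
  = let c , c₁ , c₂ , c₃ = helly r₁ r₂ r₃ d₁₂ (unsuc r₁ d₁₃) (unsuc r₂ d₂₃)
    in majority c c₁ c₂ (s≤s c₃)
  where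
  unsuc : ∀ {d} a → d < a + suc r₃ → d ≤ a + r₃
  unsuc {d} a d< = ≤-pred (subst (suc d ≤_) (+-suc a r₃) d<)
centreTail x₁ x₂ x₃ helly (suc r₁) (suc r₂) zero _ d₁₃ d₂₃
  = let c , c₁ , c₂ , c₃ = helly r₁ r₂ 0 d₁₂ (≤-pred d₁₃) (≤-pred d₂₃)
    in minority c (s≤s c₁) (s≤s c₂) c₃
  where
  d₁₂ : dH x₁ x₂ ≤ r₁ + r₂
  d₁₂ = dH-triangle-≤ x₁ x₃ x₂
          (subst (dH x₁ x₃ ≤_) (+-identityʳ r₁) (≤-pred d₁₃))
          (subst₂ _≤_ (dH-sym x₂ x₃) (+-identityʳ r₂) (≤-pred d₂₃))
centreTail x₁ x₂ x₃ helly zero     r₂       zero _ () _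
centreTail x₁ x₂ x₃ helly (suc r₁) zero     zero _ _  ()

helly : (x₁ x₂ x₃ : Vertex n) → HellyTriple x₁ x₂ x₃
helly [] [] [] _ _ _ _ _ _ = [] , z≤n , z≤n , z≤n
helly (true ∷ x₁) (true ∷ x₂) (true ∷ x₃) r₁ r₂ r₃ d₁₂ d₁₃ d₂₃ =
  let c , c₁ , c₂ , c₃ = helly x₁ x₂ x₃ r₁ r₂ r₃ d₁₂ d₁₃ d₂₃ in true ∷ c , c₁ , c₂ , c₃
helly (false ∷ x₁) (false ∷ x₂) (false ∷ x₃) r₁ r₂ r₃ d₁₂ d₁₃ d₂₃ =
  let c , c₁ , c₂ , c₃ = helly x₁ x₂ x₃ r₁ r₂ r₃ d₁₂ d₁₃ d₂₃ in false ∷ c , c₁ , c₂ , c₃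
helly (true ∷ x₁) (true ∷ x₂) (false ∷ x₃) r₁ r₂ r₃ d₁₂ d₁₃ d₂₃
  with centreTail x₁ x₂ x₃ (helly x₁ x₂ x₃) r₁ r₂ r₃ d₁₂ d₁₃ d₂₃
... | majority c c₁ c₂ c₃ = true ∷ c , c₁ , c₂ , c₃
... | minority c c₁ c₂ c₃ = false ∷ c , c₁ , c₂ , c₃
helly (false ∷ x₁) (false ∷ x₂) (true ∷ x₃) r₁ r₂ r₃ d₁₂ d₁₃ d₂₃
  with centreTail x₁ x₂ x₃ (helly x₁ x₂ x₃) r₁ r₂ r₃ d₁₂ d₁₃ d₂₃
... | majority c c₁ c₂ c₃ = false ∷ c , c₁ , c₂ , c₃
... | minority c c₁ c₂ c₃ = true ∷ c , c₁ , c₂ , c₃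
helly (true ∷ x₁) (false ∷ x₂) (true ∷ x₃) r₁ r₂ r₃ d₁₂ d₁₃ d₂₃
  with centreTail x₁ x₃ x₂ (helly x₁ x₃ x₂) r₁ r₃ r₂ d₁₃ d₁₂ (dH-≤-swap r₂ r₃ (false ∷ x₂) (true ∷ x₃) d₂₃)
... | majority c c₁ c₃ c₂ = true ∷ c , c₁ , c₂ , c₃
... | minority c c₁ c₃ c₂ = false ∷ c , c₁ , c₂ , c₃
helly (false ∷ x₁) (true ∷ x₂) (false ∷ x₃) r₁ r₂ r₃ d₁₂ d₁₃ d₂₃
  with centreTail x₁ x₃ x₂ (helly x₁ x₃ x₂) r₁ r₃ r₂ d₁₃ d₁₂ (dH-≤-swap r₂ r₃ (true ∷ x₂) (false ∷ x₃) d₂₃)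
... | majority c c₁ c₃ c₂ = false ∷ c , c₁ , c₂ , c₃
... | minority c c₁ c₃ c₂ = true ∷ c , c₁ , c₂ , c₃
helly (false ∷ x₁) (true ∷ x₂) (true ∷ x₃) r₁ r₂ r₃ d₁₂ d₁₃ d₂₃
  with centreTail x₂ x₃ x₁ (helly x₂ x₃ x₁) r₂ r₃ r₁ d₂₃
         (dH-≤-swap r₁ r₂ (false ∷ x₁) (true ∷ x₂) d₁₂) (dH-≤-swap r₁ r₃ (false ∷ x₁) (true ∷ x₃) d₁₃)
... | majority c c₂ c₃ c₁ = true ∷ c , c₁ , c₂ , c₃
... | minority c c₂ c₃ c₁ = false ∷ c , c₁ , c₂ , c₃
helly (true ∷ x₁) (false ∷ x₂) (false ∷ x₃) r₁ r₂ r₃ d₁₂ d₁₃ d₂₃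
  with centreTail x₂ x₃ x₁ (helly x₂ x₃ x₁) r₂ r₃ r₁ d₂₃
         (dH-≤-swap r₁ r₂ (true ∷ x₁) (false ∷ x₂) d₁₂) (dH-≤-swap r₁ r₃ (true ∷ x₁) (false ∷ x₃) d₁₃)
... | majority c c₂ c₃ c₁ = false ∷ c , c₁ , c₂ , c₃
... | minority c c₂ c₃ c₁ = true ∷ c , c₁ , c₂ , c₃

Distinct₃ : X → X → X → Set
Distinct₃ x y z = x ≢ y × x ≢ z × y ≢ z

∈-remove : ∀ {x : X} {xs} → x ∈ xs →
  ∃[ ys ] length xs ≡ suc (length ys) × (∀ {y} → y ∈ xs → y ≢ x → y ∈ ys)
∈-remove {xs = _ ∷ xs} (here refl) = xs , refl , λ where
  (here refl)  y≢x → ⊥-elim (y≢x refl)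
  (there y∈xs) _   → y∈xs
∈-remove {xs = x′ ∷ _} (there x∈xs) =
  let ys , len , keep = ∈-remove x∈xs in
  x′ ∷ ys , cong suc len , λ where
    (here refl)  _   → here refl
    (there y∈xs) y≢x → there (keep y∈xs y≢x)

unique-⊆⇒length-≤ : ∀ {xs ys : List X} → Unique ys → (∀ {y} → y ∈ ys → y ∈ xs) → length ys ≤ length xs
unique-⊆⇒length-≤ {ys = []}     []               _     = z≤n
unique-⊆⇒length-≤ {ys = y ∷ ys} (y∉ys ∷ unique) ys⊆xs =
  let zs , len , keep = ∈-remove (ys⊆xs (here refl)) in
  subst (_ ≤_) (sym len) (s≤s (unique-⊆⇒length-≤ unique λ y′∈ys →
    keep (ys⊆xs (there y′∈ys)) (≢-sym (All.lookup y∉ys y′∈ys))))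

distinct₃⇒3≤length : ∀ {x y z : X} {xs} → Distinct₃ x y z → x ∈ xs → y ∈ xs → z ∈ xs → 3 ≤ length xs
distinct₃⇒3≤length (x≢y , x≢z , y≢z) x∈xs y∈xs z∈xs =
  unique-⊆⇒length-≤ ((x≢y ∷ x≢z ∷ []) ∷ (y≢z ∷ []) ∷ [] ∷ []) λ where
    (here refl)                 → x∈xs
    (there (here refl))         → y∈xs
    (there (there (here refl))) → z∈xs

3≤length⇒distinct₃ : ∀ {xs : List X} → Unique xs → 3 ≤ length xs →
  ∃[ x ] ∃[ y ] ∃[ z ] Distinct₃ x y z × x ∈ xs × y ∈ xs × z ∈ xs
3≤length⇒distinct₃ {xs = x ∷ y ∷ z ∷ _} ((x≢y ∷ x≢z ∷ _) ∷ (y≢z ∷ _) ∷ _) _ =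
  x , y , z , (x≢y , x≢z , y≢z) , here refl , there (here refl) , there (there (here refl))
3≤length⇒distinct₃ {xs = _ ∷ []}     _ (s≤s ())
3≤length⇒distinct₃ {xs = _ ∷ _ ∷ []} _ (s≤s (s≤s ()))

allVertices-complete : (v : Vertex n) → v ∈ allVertices n
allVertices-complete []                  = here refl
allVertices-complete (true ∷ v)          = ∈-++⁺ˡ (∈-map⁺ (true ∷_) (allVertices-complete v))
allVertices-complete {suc n} (false ∷ v) =
  ∈-++⁺ʳ (map (true ∷_) (allVertices n)) (∈-map⁺ (false ∷_) (allVertices-complete v))

allVertices-unique : ∀ n → Unique (allVertices n)
allVertices-unique zero    = [] ∷ []
allVertices-unique (suc n) =
  Unique.++⁺ (Unique.map⁺ ∷-injectiveʳ (allVertices-unique n))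
             (Unique.map⁺ ∷-injectiveʳ (allVertices-unique n))
    λ (t∈ , f∈) → heads-differ (∈-map⁻ (true ∷_) t∈) (∈-map⁻ (false ∷_) f∈)
  where
  heads-differ : ∀ {v : Vertex (suc n)} →
    ∃[ a ] a ∈ allVertices n × v ≡ true ∷ a → ∃[ b ] b ∈ allVertices n × v ≡ false ∷ b → ⊥
  heads-differ (_ , _ , refl) (_ , _ , ())

Closed₃ : ℕ → (Vertex n → Set) → Set
Closed₃ {n} k S = ∀ {p q s} v → S p → S q → S s → Distinct₃ p q s →
  dH v p ≤ k → dH v q ≤ k → dH v s ≤ k → S v

module _ {S : Vertex n → Set} (closed : Closed₃ k S) where

  ball₁⇒universal : 3 ≤ k → (y : Vertex n) → (∀ v → dH v y ≤ 1 → S v) → ∀ v → S v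
  ball₁⇒universal 3≤k y ball₁ v = ball (dH v y) v ≤-refl
    where
    within : ∀ {d a} → d ≤ a → a ≤ 3 → d ≤ k
    within d≤a a≤3 = ≤-trans d≤a (≤-trans a≤3 3≤k)

    -- The three witnesses lie on a geodesic from v to y, or, when v is at
    -- distance 2, on the square spanned by v and y.
    sphere : ∀ m v → (∀ u → dH u y ≤ suc m → S u) → dH v y ≡ 2 + m → S v
    sphere zero v ball′ v-y with stepToward v y v-y
    ... | i , p-y =
      closed v (ball′ p (≤-reflexive p-y)) (ball′ q (≤-reflexive q-y))
        (ball′ y (≤-trans (≤-reflexive (dH-refl y)) z≤n))
        (p≢q , ≢-by-dH p-y (dH-refl y) (λ ()) , ≢-by-dH q-y (dH-refl y) (λ ()))
        (within (≤-reflexive (dH-flipAtʳ i v)) (s≤s z≤n))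
        (within (≤-reflexive (trans (dH-flipAt-swap i v y) p-y)) (s≤s z≤n))
        (within (≤-reflexive v-y) (s≤s (s≤s z≤n)))
      where
      p q : Vertex n
      p = flipAt i v
      q = flipAt i y
      q-y : dH q y ≡ 1
      q-y = dH-flipAtˡ i y
      p≢q : p ≢ q
      p≢q p≡q = ≢-by-dH v-y (dH-refl y) (λ ()) (flipAt-injective i p≡q)
    sphere (suc m) v ball′ v-y with stepToward v y v-y
    ... | i₁ , p₁-y with stepToward (flipAt i₁ v) y p₁-y
    ... | i₂ , p₂-y with stepToward (flipAt i₂ (flipAt i₁ v)) y p₂-y
    ... | i₃ , p₃-y =
      closed v (ball′ p₁ (≤-reflexive p₁-y)) (ball′ p₂ (m≤n⇒m≤1+n (≤-reflexive p₂-y)))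
        (ball′ p₃ (≤-trans (≤-reflexive p₃-y) (m≤n⇒m≤1+n (n≤1+n m))))
        (≢-by-dH p₁-y p₂-y 1+n≢n , ≢-by-dH p₁-y p₃-y (≢-sym (<⇒≢ (m<n+m m z<s))) , ≢-by-dH p₂-y p₃-y 1+n≢n)
        (within v-p₁ (s≤s z≤n)) (within v-p₂ (s≤s (s≤s z≤n))) (within v-p₃ ≤-refl)
      where
      p₁ p₂ p₃ : Vertex n
      p₁ = flipAt i₁ v
      p₂ = flipAt i₂ p₁
      p₃ = flipAt i₃ p₂
      v-p₁ : dH v p₁ ≤ 1
      v-p₁ = ≤-reflexive (dH-flipAtʳ i₁ v)
      v-p₂ : dH v p₂ ≤ 2
      v-p₂ = dH-triangle-≤ v p₁ p₂ v-p₁ (≤-reflexive (dH-flipAtʳ i₂ p₁))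
      v-p₃ : dH v p₃ ≤ 3
      v-p₃ = dH-triangle-≤ v p₂ p₃ v-p₂ (≤-reflexive (dH-flipAtʳ i₃ p₂))

    ball : ∀ m v → dH v y ≤ m → S v
    ball zero          v v-y = ball₁ v (≤-trans v-y z≤n)
    ball (suc zero)    v v-y = ball₁ v v-y
    ball (suc (suc m)) v v-y =
      [ (λ v-y< → ball (suc m) v (≤-pred v-y<)) , sphere m v (ball (suc m)) ]′ (m≤n⇒m<n∨m≡n v-y)

  near-triple⇒universal : 3 ≤ k → ∀ {p q s} y → S p → S q → S s → Distinct₃ p q s →
    dH y p < k → dH y q < k → dH y s < k → ∀ v → S v
  near-triple⇒universal 3≤k y Sp Sq Ss distinct y-p y-q y-s =
    ball₁⇒universal 3≤k y λ v v-y →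
      closed v Sp Sq Ss distinct (via v v-y y-p) (via v v-y y-q) (via v v-y y-s)
    where
    via : ∀ v {t} → dH v y ≤ 1 → dH y t < k → dH v t ≤ k
    via v {t} v-y y-t = ≤-trans (dH-triangle-≤ v y t v-y ≤-refl) y-t

≢-by-far : ∀ {a b x : Vertex n} → dH a x ≤ k → k < dH b x → a ≢ b
≢-by-far a-x k<b-x refl = <⇒≱ k<b-x a-x

1+r≤r+r : 1 ≤ r → 1 + r ≤ r + r
1+r≤r+r {r} 1≤r = +-monoˡ-≤ r 1≤r

-- y and w are c moved one step towards x₁ and towards x₂; the common neighbour
-- z of y and w joins S through x₁, x₂, c, and then x₁, c, z are within r of y.
centre-of-far-pair⇒universal : ∀ {n r} {S : Vertex n → Set} {x₁ x₂ c : Vertex n} →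
  Closed₃ (suc r) S → 2 ≤ r → S x₁ → S x₂ → S c → x₁ ≢ x₂ →
  dH c x₁ ≤ suc r → dH c x₂ ≤ suc r → r + r < dH x₁ x₂ → ∀ v → S v
centre-of-far-pair⇒universal {n} {r} {S} {x₁} {x₂} {c}
  closed 2≤r S₁ S₂ Sc x₁≢x₂ c-x₁ c-x₂ far =
  near-triple⇒universal closed (s≤s 2≤r) y S₁ Sc Sz (≢-sym c≢x₁ , x₁≢z , c≢z) y-x₁ y-c y-z
  where
  2≤k : 2 ≤ suc r
  2≤k = m≤n⇒m≤1+n 2≤r
  k<d : suc r < dH x₁ x₂
  k<d = ≤-<-trans (1+r≤r+r (≤-trans (s≤s z≤n) 2≤r)) far
  c≢x₁ : c ≢ x₁
  c≢x₁ = ≢-by-far c-x₂ k<d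
  c≢x₂ : c ≢ x₂
  c≢x₂ = ≢-by-far c-x₁ (subst (suc r <_) (dH-sym x₁ x₂) k<d)
  i j : Fin n
  i = proj₁ (stepToward-≢ c x₁ c≢x₁)
  j = proj₁ (stepToward-≢ c x₂ c≢x₂)
  y w z : Vertex n
  y = flipAt i c
  w = flipAt j c
  z = flipAt i w
  y-x₁ : dH y x₁ < suc r
  y-x₁ = <-≤-trans (proj₂ (stepToward-≢ c x₁ c≢x₁)) c-x₁
  w-x₂ : dH w x₂ < suc r
  w-x₂ = <-≤-trans (proj₂ (stepToward-≢ c x₂ c≢x₂)) c-x₂
  y-c : dH y c < suc r
  y-c = ≤-trans (s≤s (≤-reflexive (dH-flipAtˡ i c))) 2≤k
  z-y : dH z y ≡ 1
  z-y = trans (flipAt-isometry i w c) (dH-flipAtˡ j c)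
  y-z : dH y z < suc r
  y-z = ≤-trans (s≤s (≤-reflexive (trans (dH-sym y z) z-y))) 2≤k
  z-x₁ : dH z x₁ ≤ suc r
  z-x₁ = ≤-trans (dH-triangle-≤ z y x₁ (≤-reflexive z-y) ≤-refl) y-x₁
  z-x₂ : dH z x₂ ≤ suc r
  z-x₂ = ≤-trans (dH-triangle-≤ z w x₂ (≤-reflexive (dH-flipAtˡ i w)) ≤-refl) w-x₂
  z-c : dH z c ≤ suc r
  z-c = ≤-trans (dH-triangle-≤ z y c (≤-reflexive z-y) (≤-reflexive (dH-flipAtˡ i c))) 2≤k
  Sz : S z
  Sz = closed z S₁ S₂ Sc (x₁≢x₂ , ≢-sym c≢x₁ , ≢-sym c≢x₂) z-x₁ z-x₂ z-c
  y≢w : y ≢ w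
  y≢w y≡w = <⇒≱ far (dH-triangle-≤ x₁ y x₂
    (≤-pred (subst (_< suc r) (dH-sym y x₁) y-x₁)) (≤-pred (subst (λ t → dH t x₂ < suc r) (sym y≡w) w-x₂)))
  c≢z : c ≢ z
  c≢z c≡z = y≢w (trans (cong (flipAt i) c≡z) (flipAt-involutive i w))
  x₁≢z : x₁ ≢ z
  x₁≢z = ≢-sym (≢-by-far z-x₂ k<d)

far-pair⇒universal : Closed₃ (suc r) S → 2 ≤ r → S x₁ → S x₂ → S x₃ → Distinct₃ x₁ x₂ x₃ →
  dH x₁ x₂ ≤ suc r + suc r → dH x₁ x₃ ≤ suc r + suc r → dH x₂ x₃ ≤ suc r + suc r →
  r + r < dH x₁ x₂ → ∀ v → S v
far-pair⇒universal {r = r} {x₁ = x₁} {x₂ = x₂} {x₃ = x₃}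
  closed 2≤r S₁ S₂ S₃ distinct@(x₁≢x₂ , _ , _) d₁₂ d₁₃ d₂₃ far =
  let c , c-x₁ , c-x₂ , c-x₃ = helly x₁ x₂ x₃ (suc r) (suc r) (suc r) d₁₂ d₁₃ d₂₃
      Sc = closed c S₁ S₂ S₃ distinct c-x₁ c-x₂ c-x₃
  in centre-of-far-pair⇒universal closed 2≤r S₁ S₂ Sc x₁≢x₂ c-x₁ c-x₂ far

closed₃⇒universal : Closed₃ k S → 3 ≤ k → S x₁ → S x₂ → S x₃ → Distinct₃ x₁ x₂ x₃ →
  dH x₁ x₂ ≤ k + k → dH x₁ x₃ ≤ k + k → dH x₂ x₃ ≤ k + k → ∀ v → S v
closed₃⇒universal {k = suc r} {x₁ = x₁} {x₂ = x₂} {x₃ = x₃}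
  closed 3≤k@(s≤s 2≤r) S₁ S₂ S₃ distinct@(x₁≢x₂ , x₁≢x₃ , x₂≢x₃) d₁₂ d₁₃ d₂₃
  with dH x₁ x₂ ≤? r + r | dH x₁ x₃ ≤? r + r | dH x₂ x₃ ≤? r + r
... | no far | _ | _ = far-pair⇒universal closed 2≤r S₁ S₂ S₃ distinct d₁₂ d₁₃ d₂₃ (≰⇒> far)
... | _ | no far | _ = far-pair⇒universal closed 2≤r S₁ S₃ S₂ (x₁≢x₃ , x₁≢x₂ , ≢-sym x₂≢x₃)
                        d₁₃ d₁₂ (subst (_≤ _) (dH-sym x₂ x₃) d₂₃) (≰⇒> far)
... | _ | _ | no far = far-pair⇒universal closed 2≤r S₂ S₃ S₁ (x₂≢x₃ , ≢-sym x₁≢x₂ , ≢-sym x₁≢x₃)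
                        d₂₃ (subst (_≤ _) (dH-sym x₁ x₂) d₁₂) (subst (_≤ _) (dH-sym x₁ x₃) d₁₃) (≰⇒> far)
... | yes near₁₂ | yes near₁₃ | yes near₂₃ =
  let c , c-x₁ , c-x₂ , c-x₃ = helly x₁ x₂ x₃ r r r near₁₂ near₁₃ near₂₃
  in near-triple⇒universal closed 3≤k c S₁ S₂ S₃ distinct (s≤s c-x₁) (s≤s c-x₂) (s≤s c-x₃)

InfectedNeighbour : ℕ → VSet n → Vertex n → Vertex n → Set
InfectedNeighbour k B v u = (adjᵇ k v u ∧ B u) ≡ true

infectedNeighbour : ∀ {B : VSet n} {v u} → v ≢ u → dH v u ≤ k → B u ≡ true → InfectedNeighbour k B v u
infectedNeighbour {v = v} {u} v≢u v-u Bu =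
  T-≡ .to (T-∧ .from (T-∧ .from (≤⇒≤ᵇ 0<v-u , ≤⇒≤ᵇ v-u) , T-≡ .from Bu))
  where
  0<v-u : 0 < dH v u
  0<v-u = n≢0⇒n>0 (v≢u ∘ dH≡0⇒≡ v u)

infectedNeighbour⁻ : ∀ {B : VSet n} {v u} → InfectedNeighbour k B v u → dH v u ≤ k × B u ≡ true
infectedNeighbour⁻ {v = v} {u} nb =
  let adj , Bu = T-∧ .to (T-≡ .from nb) in ≤ᵇ⇒≤ (dH v u) _ (proj₂ (T-∧ .to adj)) , T-≡ .to Bu

nbrCount-mono : ∀ {B C : VSet n} {v} → (∀ u → B u ≡ true → C u ≡ true) → nbrCount k B v ≤ nbrCount k C v
nbrCount-mono {n = n} {B = B} {C} B⊆C =
  length-mono-≤ (filter⁺ _ _ (λ { refl → ∧-monoʳ }) (⊆-refl {x = allVertices n}))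
  where
  ∧-monoʳ : ∀ {a u} → (a ∧ B u) ≡ true → (a ∧ C u) ≡ true
  ∧-monoʳ {true} = B⊆C _

neighbours⇒3≤nbrCount : ∀ {B : VSet n} {v p q s} → Distinct₃ p q s →
  InfectedNeighbour k B v p → InfectedNeighbour k B v q → InfectedNeighbour k B v s → 3 ≤ nbrCount k B v
neighbours⇒3≤nbrCount {p = p} {q} {s} distinct v-p v-q v-s = distinct₃⇒3≤length distinct
  (∈-filter⁺ _ (allVertices-complete p) v-p)
  (∈-filter⁺ _ (allVertices-complete q) v-q)
  (∈-filter⁺ _ (allVertices-complete s) v-s)

3≤nbrCount⇒neighbours : ∀ {B : VSet n} {v} → 3 ≤ nbrCount k B v → ∃[ p ] ∃[ q ] ∃[ s ]
  Distinct₃ p q s × InfectedNeighbour k B v p × InfectedNeighbour k B v q × InfectedNeighbour k B v s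
3≤nbrCount⇒neighbours {n = n} three =
  let p , q , s , distinct , p∈ , q∈ , s∈ = 3≤length⇒distinct₃ (Unique.filter⁺ _ (allVertices-unique n)) three
  in p , q , s , distinct , proj₂ (∈-filter⁻ _ {xs = allVertices n} p∈)
     , proj₂ (∈-filter⁻ _ {xs = allVertices n} q∈) , proj₂ (∈-filter⁻ _ {xs = allVertices n} s∈)

module Process (k r : ℕ) (A₀ : VSet n) where

  A : ℕ → VSet n
  A = infected k r A₀

  Eventually : Vertex n → Set
  Eventually v = ∃[ i ] A i v ≡ true

  infected-by-neighbours : ∀ i v → r ≤ nbrCount k (A i) v → A (suc i) v ≡ true
  infected-by-neighbours i v many = trans (cong (A i v ∨_) (T-≡ .to (≤⇒≤ᵇ many))) (∨-zeroʳ (A i v))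

  newly-infected : ∀ i v → A (suc i) v ≡ true → A i v ≡ true ⊎ r ≤ nbrCount k (A i) v
  newly-infected i v Av with A i v
  ... | true  = inj₁ refl
  ... | false = inj₂ (≤ᵇ⇒≤ r _ (T-≡ .from Av))

  A-suc : ∀ i v → A i v ≡ true → A (suc i) v ≡ true
  A-suc i v Aiv = cong (_∨ (r ≤ᵇ nbrCount k (A i) v)) Aiv

  A-mono : ∀ {i j v} → i ≤ j → A i v ≡ true → A j v ≡ true
  A-mono {v = v} i≤j = go (≤⇒≤′ i≤j)
    where
    go : ∀ {i j} → i ≤′ j → A i v ≡ true → A j v ≡ true
    go ≤′-refl                Aiv = Aiv
    go (≤′-step {n = j} i≤′j) Aiv = A-suc j v (go i≤′j Aiv)

  eventually-uniform : (vs : List (Vertex n)) → (∀ v → Eventually v) → ∃[ i ] All (λ v → A i v ≡ true) vs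
  eventually-uniform []       _  = 0 , []
  eventually-uniform (v ∷ vs) ev =
    let i , Aiv  = ev v
        j , Ajvs = eventually-uniform vs ev
    in i ⊔ j , A-mono (m≤m⊔n i j) Aiv ∷ All.map (A-mono (m≤n⊔m i j)) Ajvs

  eventually⇒percolates : (∀ v → Eventually v) → Percolates k r A₀
  eventually⇒percolates ev =
    let i , Ai-all = eventually-uniform (allVertices n) ev
    in i , λ v → All.lookup Ai-all (allVertices-complete v)

  eventually-closed₃ : r ≤ 3 → Closed₃ k Eventually
  eventually-closed₃ r≤3 {p} {q} {s} v (i , Aip) (j , Ajq) (l , Als) distinct v-p v-q v-s
    with v ≟ᵛ p | v ≟ᵛ q | v ≟ᵛ s
  ... | yes refl | _        | _        = i , Aip
  ... | no _     | yes refl | _        = j , Ajq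
  ... | no _     | no _     | yes refl = l , Als
  ... | no v≢p   | no v≢q   | no v≢s   =
    suc t , infected-by-neighbours t v (≤-trans r≤3 (neighbours⇒3≤nbrCount {B = A t} {v = v} distinct
      (neighbour v≢p v-p (≤-trans (m≤m⊔n i j) (m≤m⊔n _ l)) Aip)
      (neighbour v≢q v-q (≤-trans (m≤n⊔m i j) (m≤m⊔n _ l)) Ajq)
      (neighbour v≢s v-s (m≤n⊔m (i ⊔ j) l) Als)))
    where
    t : ℕ
    t = i ⊔ j ⊔ l
    neighbour : ∀ {u i} → v ≢ u → dH v u ≤ k → i ≤ t → A i u ≡ true → InfectedNeighbour k (A t) v u
    neighbour v≢u v-u i≤t Aiu = infectedNeighbour {k = k} {B = A t} {v = v} v≢u v-u (A-mono i≤t Aiu)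

  no-spreader⇒A⊆A₀ : (∀ u → ¬ r ≤ nbrCount k A₀ u) → ∀ i v → A i v ≡ true → A₀ v ≡ true
  no-spreader⇒A⊆A₀ _    zero    v A₀v = A₀v
  no-spreader⇒A⊆A₀ none (suc i) v Av with newly-infected i v Av
  ... | inj₁ Aiv  = no-spreader⇒A⊆A₀ none i v Aiv
  ... | inj₂ many = ⊥-elim (none v (≤-trans many
                      (nbrCount-mono {k = k} {B = A i} {C = A₀} {v = v} (no-spreader⇒A⊆A₀ none i))))

  percolates⇒spreader : ∀ {w} → Percolates k r A₀ → A₀ w ≡ false → ∃[ u ] r ≤ nbrCount k A₀ u
  percolates⇒spreader {w} (i , Ai-all) A₀w with any? (λ u → r ≤? nbrCount k A₀ u) (allVertices n)
  ... | yes spreader = satisfied spreader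
  ... | no  none     = ⊥-elim (not-¬ (no-spreader⇒A⊆A₀ none′ i w (Ai-all w)) A₀w)
    where
    none′ : ∀ u → ¬ r ≤ nbrCount k A₀ u
    none′ u = All.lookup (¬Any⇒All¬ _ none) (allVertices-complete u)

CloseTriple : ℕ → VSet n → Set
CloseTriple {n} k B = ∃[ x₁ ] ∃[ x₂ ] ∃[ x₃ ]
  (B x₁ ≡ true × B x₂ ≡ true × B x₃ ≡ true
   × x₁ ≢ x₂ × x₁ ≢ x₃ × x₂ ≢ x₃
   × dH x₁ x₂ ≤ 2 * k × dH x₁ x₃ ≤ 2 * k × dH x₂ x₃ ≤ 2 * k)

k+k≡2*k : ∀ k → k + k ≡ 2 * k
k+k≡2*k k = cong (k +_) (sym (+-identityʳ k))

3≤nbrCount⇒close-triple : ∀ {B : VSet n} {u} → 3 ≤ nbrCount k B u → CloseTriple k B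
3≤nbrCount⇒close-triple {k = k} {B = B} {u = u} three =
  let x₁ , x₂ , x₃ , (x₁≢x₂ , x₁≢x₃ , x₂≢x₃) , n₁ , n₂ , n₃ =
        3≤nbrCount⇒neighbours {k = k} {B = B} {v = u} three
      u-x₁ , Bx₁ = infectedNeighbour⁻ {k = k} {B = B} {v = u} n₁
      u-x₂ , Bx₂ = infectedNeighbour⁻ {k = k} {B = B} {v = u} n₂
      u-x₃ , Bx₃ = infectedNeighbour⁻ {k = k} {B = B} {v = u} n₃
  in x₁ , x₂ , x₃ , Bx₁ , Bx₂ , Bx₃ , x₁≢x₂ , x₁≢x₃ , x₂≢x₃
     , via-u u-x₁ u-x₂ , via-u u-x₁ u-x₃ , via-u u-x₂ u-x₃
  where
  via-u : ∀ {x y} → dH u x ≤ k → dH u y ≤ k → dH x y ≤ 2 * k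
  via-u {x} {y} u-x u-y =
    subst (dH x y ≤_) (k+k≡2*k k) (dH-triangle-≤ x u y (subst (_≤ k) (dH-sym u x) u-x) u-y)

lemma3p4 : (n k : ℕ) → 3 ≤ k → (A₀ : VSet n) → (∃[ w ] A₀ w ≡ false) →
    (Percolates k 3 A₀ ⇔ (∃[ x₁ ] ∃[ x₂ ] ∃[ x₃ ]
      (A₀ x₁ ≡ true × A₀ x₂ ≡ true × A₀ x₃ ≡ true
       × x₁ ≢ x₂ × x₁ ≢ x₃ × x₂ ≢ x₃
       × dH x₁ x₂ ≤ 2 * k × dH x₁ x₃ ≤ 2 * k × dH x₂ x₃ ≤ 2 * k)))
lemma3p4 _ k 3≤k A₀ (w , A₀w) = mk⇔ percolates⇒close-triple close-triple⇒percolates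
  where
  open Process k 3 A₀

  percolates⇒close-triple : Percolates k 3 A₀ → CloseTriple k A₀
  percolates⇒close-triple perc =
    let u , three = percolates⇒spreader perc A₀w in 3≤nbrCount⇒close-triple {B = A₀} {u = u} three

  close-triple⇒percolates : CloseTriple k A₀ → Percolates k 3 A₀
  close-triple⇒percolates (x₁ , x₂ , x₃ , A₀x₁ , A₀x₂ , A₀x₃ , x₁≢x₂ , x₁≢x₃ , x₂≢x₃ , d₁₂ , d₁₃ , d₂₃) =
    eventually⇒percolates (closed₃⇒universal (eventually-closed₃ ≤-refl) 3≤k
      (0 , A₀x₁) (0 , A₀x₂) (0 , A₀x₃) (x₁≢x₂ , x₁≢x₃ , x₂≢x₃) (≤2k d₁₂) (≤2k d₁₃) (≤2k d₂₃))
    where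
    ≤2k : ∀ {d} → d ≤ 2 * k → d ≤ k + k
    ≤2k {d} = subst (d ≤_) (sym (k+k≡2*k k))
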